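{- For every integer $n \geq 2$, \[ L_n^{2,1} = \phi(n), \qquad L_n^{3,1} = \sum_{k=1}^{n-1}\phi(k) - \phi(n), \qquad L_n^{2,2} = (n-2)\,\phi(n), \] where $\phi$ is Euler's totient function ($\phi(m)$ is the number of integers $1\le j\le m$ with $\gcd(j,m)=1$; in particular $\phi(1)=1$) and $L_n^{k^+,k^- }$ is the number of $(k^+,k^-)$-lieanders with sum $n$.
   Context: A composition of a positive integer $n$ is a finite sequence $c=(c_1,\ldots,c_k)$ of positive integers with $c_1+\cdots+c_k=n$; $k$ is its length. To such a composition associate the fixed-point-free involution $\sigma_c$ of $\{1,\ldots,2n\}$ defined as follows: split $\{1,\ldots,2n\}$ into consecutive intervals $I_1=\{1,\ldots,2c_1\}$, $I_2=\{2c_1+1,\ldots,2(c_1+c_2)\}$, \ldots, $I_k=\{2(c_1+\cdots+c_{k-1})+1,\ldots,2n\}$, and let $\sigma_c$ be the involution reversing the order on each $I_j$. A pair $(c^+,c^-)$ of compositions of the same integer $n$ is a lieander if the group $\langle \sigma_{c^+},\sigma_{c^- }\rangle$ acts transitively on $\{1,\ldots,2n\}$. A $(k^+,k^-)$-lieander is a lieander $(c^+,c^-)$ with $c^+$ of length $k^+$ and $c^-$ of length $k^-$; its sum is $n$. -}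

module Defs where

open import Data.Nat using (ℕ; zero; suc; _+_; _*_; _∸_; _≤_; _≤?_)
open import Data.Nat.GCD using (gcd)
open import Data.Nat.Properties using (_≟_)
open import Data.List using (List; []; _∷_; length; filter; upTo; map)
open import Data.Nat.ListAction using (sum)
open import Data.List.Relation.Unary.All using (All)
open import Data.List.Relation.Unary.Unique.Propositional using (Unique)
open import Data.List.Membership.Propositional using (_∈_)
open import Data.Product using (_×_)
open import Relation.Binary.PropositionalEquality using (_≡_)
open import Relation.Nullary using (does)
open import Data.Bool using (if_then_else_)
open import Function.Bundles using (_⇔_)

φ : ℕ → ℕ
φ m = length (filter (λ j → gcd j m ≟ 1) (map suc (upTo m)))

IsComposition : ℕ → ℕ → List ℕ → Set
IsComposition n k c = All (λ x → 1 ≤ x) c × length c ≡ k × sum c ≡ n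

-- σ_c acting on points 1,…,2n (1-based; values outside 1..2n are irrelevant):
-- reverses the order on each block I_j of size 2 c_j.
σ : List ℕ → ℕ → ℕ
σ [] i = i
σ (c ∷ cs) i = if does (i ≤? 2 * c) then (2 * c + 1) ∸ i else 2 * c + σ cs (i ∸ 2 * c)

-- j lies in the orbit of i under the group ⟨σ_{c⁺}, σ_{c⁻}⟩
-- (both generators are involutions, so the group elements are the words in them).
data Reach (c⁺ c⁻ : List ℕ) : ℕ → ℕ → Set where
  here  : ∀ {i} → Reach c⁺ c⁻ i i
  step⁺ : ∀ {i j} → Reach c⁺ c⁻ i j → Reach c⁺ c⁻ i (σ c⁺ j)
  step⁻ : ∀ {i j} → Reach c⁺ c⁻ i j → Reach c⁺ c⁻ i (σ c⁻ j)

Transitive : ℕ → List ℕ → List ℕ → Set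
Transitive n c⁺ c⁻ = ∀ i j → 1 ≤ i → i ≤ 2 * n → 1 ≤ j → j ≤ 2 * n → Reach c⁺ c⁻ i j

IsLieander : ℕ → ℕ → ℕ → List ℕ × List ℕ → Set
IsLieander n k⁺ k⁻ (c⁺ Data.Product., c⁻) =
  IsComposition n k⁺ c⁺ × IsComposition n k⁻ c⁻ × Transitive n c⁺ c⁻

HasCount : {A : Set} → (A → Set) → ℕ → Set
HasCount {A} P m = Data.Product.Σ (List A) λ xs →
  Unique xs × length xs ≡ m × (∀ x → (x ∈ xs) ⇔ P x)

L : ℕ → ℕ → ℕ → ℕ → Set
L n k⁺ k⁻ m = HasCount (IsLieander n k⁺ k⁻) m

sumφBelow : ℕ → ℕ
sumφBelow n = sum (map φ (map suc (upTo (n ∸ 1))))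

-- Points 1, …, 2 n are handled as positions y = 0, …, 2 n − 1.  On each of its blocks σ_c is a
-- reflection y ↦ K − 1 − y, and for a two-part composition (a, n − a) both blocks give the same
-- reflection modulo 2 n.  Composing the reflections of c⁺ and c⁻ gives a translation: by 2 (n − a)
-- for (a, n − a), (n); by 2 (b + n − a) for (a, n − a), (b, n − b); and for (a, b, c), (n) by
-- 2 (b + c) on a circle of 2 (a + b) + 2 (b + c) positions, the last 2 b of which are copies of
-- points.  A translation by 2 d on a circle of 2 N positions reaches every position of the same
-- parity when gcd d N = 1, and σ_{c⁻} changes parity, so the action is then transitive.  If
-- instead g = gcd d N > 1, both generators are the same reflection modulo 2 g, so the orbit of a
-- position x lies in the classes of x and K − 1 − x, which cannot contain both 1 and 2 when x = 0.
-- The lieanders are thus parametrised by a with gcd a n = 1, by (a, b) with gcd (b − a) n = 1 and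
-- by (s, t) = (a + b, b + c) with s + t > n and gcd s t = 1.  Counting them uses that any m
-- consecutive integers contain exactly φ m units modulo m: for fixed a the values b + n − a fill
-- such a window with one element missing, and for fixed s the admissible t fill the window
-- (n − s, n] of length s except for t = n.

module Submission where

open import Defs
open import Data.Nat using (ℕ; zero; suc; _+_; _*_; _∸_; _≤_; _<_; _≤?_; _<?_; z≤n; s≤s)
open import Data.Nat.Properties
open import Data.Nat.DivMod using (_%_; [m+kn]%n≡m%n; m<n⇒m%n≡m)
open import Data.Nat.GCD using (gcd; module Bézout; gcd-GCD; gcd-comm; gcd-greatest; gcd[m,n]∣m; gcd[m,n]∣n; gcd[m,n]≡0⇒m≡0; gcd-identityʳ)
open import Data.Nat.Divisibility using (_∣_; divides; ∣m+n∣m⇒∣n; ∣m∣n⇒∣m+n; ∣-antisym; *-monoʳ-∣; n∣m*n; m∣m*n)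
open import Data.Nat.Tactic.RingSolver using (solve-∀)
open import Data.Product using (_×_; Σ; _,_; proj₁; proj₂; ∃; ∃₂)
open import Data.Sum using (_⊎_; inj₁; inj₂)
open import Relation.Binary.PropositionalEquality hiding ([_])
open import Relation.Nullary using (¬_; yes; no; does; contradiction)
open import Data.Bool using (true; false; if_then_else_)
open import Data.Empty using (⊥; ⊥-elim)
open import Data.List using (List; []; _∷_; _++_; [_]; map; length; filter; upTo; cartesianProduct)
open import Data.List.Properties using (∷-injectiveˡ; ∷-injectiveʳ; filter-++; length-++; length-map; map-++; applyUpTo-∷ʳ; filter-none)
open import Data.List.Membership.Propositional using (_∈_)
open import Data.List.Membership.Propositional.Properties using (∈-cartesianProduct⁺; ∈-cartesianProduct⁻; ∈-filter⁻; ∈-map∘filter⁻; ∈-map∘filter⁺)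
open import Data.List.Relation.Unary.Any using (here; there)
import Data.List.Relation.Unary.All as All
import Data.List.Relation.Unary.All.Properties as All
open import Data.List.Relation.Unary.AllPairs using ([]; _∷_)
open import Data.List.Relation.Unary.Unique.Propositional using (Unique)
import Data.List.Relation.Unary.Unique.Propositional.Properties as Unique
open import Data.Nat.ListAction using (sum)
open import Relation.Unary using (Decidable)
open import Relation.Nullary.Decidable using (dec-true; dec-false; decidable-stable; _×-dec_)
open import Data.Product.Properties using (,-injectiveˡ; ,-injectiveʳ)
open import Function.Bundles using (_⇔_; mk⇔; module Equivalence)
open import Level using (0ℓ)
open import Relation.Binary.Bundles using (Setoid)
import Relation.Binary.Reasoning.Setoid

-- Congruences of natural numbers

infix 4 _≡_[mod_]

_≡_[mod_] : ℕ → ℕ → ℕ → Set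
a ≡ b [mod m ] = ∃₂ λ q r → a + q * m ≡ b + r * m

module _ {m : ℕ} where

  mod-refl : ∀ {a} → a ≡ a [mod m ]
  mod-refl = 0 , 0 , refl

  mod-reflexive : ∀ {a b} → a ≡ b → a ≡ b [mod m ]
  mod-reflexive refl = mod-refl

  mod-sym : ∀ {a b} → a ≡ b [mod m ] → b ≡ a [mod m ]
  mod-sym (q , r , e) = r , q , sym e

  mod-trans : ∀ {a b c} → a ≡ b [mod m ] → b ≡ c [mod m ] → a ≡ c [mod m ]
  mod-trans {a} {b} {c} (q , r , e) (q′ , r′ , e′) = q + q′ , r′ + r , (begin
    a + (q + q′) * m      ≡⟨ shift a q q′ m ⟩
    (a + q * m) + q′ * m  ≡⟨ cong (_+ q′ * m) e ⟩
    (b + r * m) + q′ * m  ≡⟨ swap b r q′ m ⟩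
    (b + q′ * m) + r * m  ≡⟨ cong (_+ r * m) e′ ⟩
    (c + r′ * m) + r * m  ≡⟨ sym (shift c r′ r m) ⟩
    c + (r′ + r) * m      ∎)
    where
    open ≡-Reasoning
    shift : ∀ a q q′ m → a + (q + q′) * m ≡ (a + q * m) + q′ * m
    shift = solve-∀
    swap : ∀ b r q′ m → (b + r * m) + q′ * m ≡ (b + q′ * m) + r * m
    swap = solve-∀

  +-mod : ∀ {a b c d} → a ≡ b [mod m ] → c ≡ d [mod m ] → a + c ≡ b + d [mod m ]
  +-mod {a} {b} {c} {d} (q , r , e) (q′ , r′ , e′) = q + q′ , r + r′ , (begin
    (a + c) + (q + q′) * m      ≡⟨ interchange a c q q′ m ⟩
    (a + q * m) + (c + q′ * m)  ≡⟨ cong₂ _+_ e e′ ⟩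
    (b + r * m) + (d + r′ * m)  ≡⟨ sym (interchange b d r r′ m) ⟩
    (b + d) + (r + r′) * m      ∎)
    where
    open ≡-Reasoning
    interchange : ∀ a c q q′ m → (a + c) + (q + q′) * m ≡ (a + q * m) + (c + q′ * m)
    interchange = solve-∀

  +-cancelʳ-mod : ∀ {a b} c → a + c ≡ b + c [mod m ] → a ≡ b [mod m ]
  +-cancelʳ-mod {a} {b} c (q , r , e) = q , r , +-cancelʳ-≡ c _ _ (begin
    (a + q * m) + c  ≡⟨ swap a q m c ⟩
    (a + c) + q * m  ≡⟨ e ⟩
    (b + c) + r * m  ≡⟨ sym (swap b r m c) ⟩
    (b + r * m) + c  ∎)
    where
    open ≡-Reasoning
    swap : ∀ a q m c → (a + q * m) + c ≡ (a + c) + q * m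
    swap = solve-∀

  +-*-mod : ∀ a k → a + k * m ≡ a [mod m ]
  +-*-mod a k = 0 , k , +-identityʳ _

  *-congˡ-mod : ∀ {a b} c → a ≡ b [mod m ] → c * a ≡ c * b [mod m ]
  *-congˡ-mod {a} {b} c (q , r , e) = c * q , c * r , (begin
    c * a + c * q * m  ≡⟨ distrib c a q m ⟩
    c * (a + q * m)    ≡⟨ cong (c *_) e ⟩
    c * (b + r * m)    ≡⟨ sym (distrib c b r m) ⟩
    c * b + c * r * m  ∎)
    where
    open ≡-Reasoning
    distrib : ∀ c a q m → c * a + c * q * m ≡ c * (a + q * m)
    distrib = solve-∀

  *-mod-* : ∀ {a b} c → a ≡ b [mod m ] → c * a ≡ c * b [mod c * m ]
  *-mod-* {a} {b} c (q , r , e) = q , r , (begin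
    c * a + q * (c * m)  ≡⟨ distrib c a q m ⟩
    c * (a + q * m)      ≡⟨ cong (c *_) e ⟩
    c * (b + r * m)      ≡⟨ sym (distrib c b r m) ⟩
    c * b + r * (c * m)  ∎)
    where
    open ≡-Reasoning
    distrib : ∀ c a q m → c * a + q * (c * m) ≡ c * (a + q * m)
    distrib = solve-∀

  +-≡0-mod : ∀ {a b} → b ≡ 0 [mod m ] → a + b ≡ a [mod m ]
  +-≡0-mod {a} b≡0 = mod-trans (+-mod (mod-refl {a = a}) b≡0) (mod-reflexive (+-identityʳ a))

  ∣⇒≡0-mod : ∀ {a} → m ∣ a → a ≡ 0 [mod m ]
  ∣⇒≡0-mod (divides q refl) = 0 , q , +-identityʳ _

  ≡0-mod⇒∣ : ∀ {a} → a ≡ 0 [mod m ] → m ∣ a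
  ≡0-mod⇒∣ {a} (q , r , e) = ∣m+n∣m⇒∣n (subst (m ∣_) (trans (sym e) (+-comm a (q * m))) (n∣m*n r)) (n∣m*n q)

≡-mod-setoid : ℕ → Setoid 0ℓ 0ℓ
≡-mod-setoid m = record
  { Carrier = ℕ
  ; _≈_ = λ a b → a ≡ b [mod m ]
  ; isEquivalence = record { refl = mod-refl ; sym = mod-sym ; trans = mod-trans }
  }

module ≡-mod-Reasoning (m : ℕ) = Relation.Binary.Reasoning.Setoid (≡-mod-setoid m)

mod-<⇒≡ : ∀ {m a b} → a < m → b < m → a ≡ b [mod m ] → a ≡ b
mod-<⇒≡ {suc m} {a} {b} a<m b<m (q , r , e) = begin
  a                      ≡⟨ sym (m<n⇒m%n≡m a<m) ⟩
  a % suc m              ≡⟨ sym ([m+kn]%n≡m%n a q (suc m)) ⟩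
  (a + q * suc m) % suc m  ≡⟨ cong (_% suc m) e ⟩
  (b + r * suc m) % suc m  ≡⟨ [m+kn]%n≡m%n b r (suc m) ⟩
  b % suc m              ≡⟨ m<n⇒m%n≡m b<m ⟩
  b                      ∎
  where open ≡-Reasoning

mod-∣ : ∀ {d m a b} → d ∣ m → a ≡ b [mod m ] → a ≡ b [mod d ]
mod-∣ {d} {a = a} {b} (divides k refl) (q , r , e) = q * k , r * k ,
  trans (cong (a +_) (*-assoc q k d)) (trans e (cong (b +_) (sym (*-assoc r k d))))

∣⇒2*≡0-mod : ∀ {g a} → g ∣ a → 2 * a ≡ 0 [mod 2 * g ]
∣⇒2*≡0-mod g∣a = ∣⇒≡0-mod (*-monoʳ-∣ 2 g∣a)

Even : ℕ → Set
Even x = x ≡ 0 [mod 2 ]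

even-or-odd : ∀ x → Even x ⊎ Even (suc x)
even-or-odd zero = inj₁ mod-refl
even-or-odd (suc x) with even-or-odd x
... | inj₁ even = inj₂ (+-mod {a = 2} (0 , 1 , refl) even)
... | inj₂ odd  = inj₁ odd

even-gap : ∀ {N x z} → x ≤ 2 * N → Even (x + z) → ∃ λ e → x + 2 * e ≡ z [mod 2 * N ]
even-gap {N} {x} {z} x≤2N x+z-even with ≡0-mod⇒∣ x+z-even | m≤n⇒∃[o]m+o≡n x≤2N
... | divides w x+z≡w*2 | v , x+v≡2N = w + v , 0 , 2 , (begin
  x + 2 * (w + v) + 0  ≡⟨ expand x w v ⟩
  x + w * 2 + 2 * v    ≡⟨ cong (λ t → x + t + 2 * v) (sym x+z≡w*2) ⟩
  x + (x + z) + 2 * v  ≡⟨ regroup x z v ⟩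
  z + 2 * (x + v)      ≡⟨ cong (λ t → z + 2 * t) x+v≡2N ⟩
  z + 2 * (2 * N)      ∎)
  where
  open ≡-Reasoning
  expand : ∀ x w v → x + 2 * (w + v) + 0 ≡ x + w * 2 + 2 * v
  expand = solve-∀
  regroup : ∀ x z v → x + (x + z) + 2 * v ≡ z + 2 * (x + v)
  regroup = solve-∀

-- Greatest common divisors

gcd[m+n,m]≡gcd[n,m] : ∀ m n → gcd (m + n) m ≡ gcd n m
gcd[m+n,m]≡gcd[n,m] m n = ∣-antisym
  (gcd-greatest (∣m+n∣m⇒∣n (gcd[m,n]∣m (m + n) m) (gcd[m,n]∣n (m + n) m)) (gcd[m,n]∣n (m + n) m))
  (gcd-greatest (∣m∣n⇒∣m+n (gcd[m,n]∣n n m) (gcd[m,n]∣m n m)) (gcd[m,n]∣n n m))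

gcd[m,m+n]≡gcd[m,n] : ∀ m n → gcd m (m + n) ≡ gcd m n
gcd[m,m+n]≡gcd[m,n] m n = trans (gcd-comm m (m + n)) (trans (gcd[m+n,m]≡gcd[n,m] m n) (gcd-comm n m))

gcd[n∸m,n]≡gcd[m,n] : ∀ {m n} → m ≤ n → gcd (n ∸ m) n ≡ gcd m n
gcd[n∸m,n]≡gcd[m,n] {m} {n} m≤n = begin
  gcd (n ∸ m) n              ≡⟨ cong (gcd (n ∸ m)) (sym (m∸n+n≡m m≤n)) ⟩
  gcd (n ∸ m) ((n ∸ m) + m)  ≡⟨ gcd[m,m+n]≡gcd[m,n] (n ∸ m) m ⟩
  gcd (n ∸ m) m              ≡⟨ gcd-comm (n ∸ m) m ⟩
  gcd m (n ∸ m)              ≡⟨ sym (gcd[m,m+n]≡gcd[m,n] m (n ∸ m)) ⟩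
  gcd m (m + (n ∸ m))        ≡⟨ cong (gcd m) (m+[n∸m]≡n m≤n) ⟩
  gcd m n                    ∎
  where open ≡-Reasoning

gcd[n,n]≡n : ∀ n → gcd n n ≡ n
gcd[n,n]≡n n = trans (cong (gcd n) (sym (+-identityʳ n))) (trans (gcd[m,m+n]≡gcd[m,n] n 0) (gcd-identityʳ n))

gcd≢1⇒2≤gcd : ∀ {m k} → 1 ≤ m → gcd m k ≢ 1 → 2 ≤ gcd m k
gcd≢1⇒2≤gcd {m} {k} 1≤m gcd≢1 with gcd m k in eq
... | 0           = ⊥-elim (<⇒≢ 1≤m (sym (gcd[m,n]≡0⇒m≡0 eq)))
... | 1           = ⊥-elim (gcd≢1 refl)
... | suc (suc _) = s≤s (s≤s z≤n)

≡1-resp : ∀ {x y} → x ≡ y → (x ≡ 1) ⇔ (y ≡ 1)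
≡1-resp x≡y = mk⇔ (trans (sym x≡y)) (trans x≡y)

coprime⇒inverse : ∀ {d N} → 1 ≤ N → gcd d N ≡ 1 → ∃ λ u → d * u ≡ 1 [mod N ]
coprime⇒inverse {d} {N} _ gcd≡1 with Bézout.identity (gcd-GCD d N)
... | Bézout.+- x y eq =
  x , 0 , y , trans (+-identityʳ (d * x)) (trans (*-comm d x) (sym (trans (cong (_+ y * N) (sym gcd≡1)) eq)))
coprime⇒inverse {d} {suc N} _ gcd≡1 | Bézout.-+ x y eq = x * N , 1 , y * N , (begin
  d * (x * N) + 1 * suc N  ≡⟨ expand d x N ⟩
  (1 + x * d) * N + 1      ≡⟨ cong (λ t → t * N + 1) (trans (cong (_+ x * d) (sym gcd≡1)) eq) ⟩
  y * suc N * N + 1        ≡⟨ regroup y N ⟩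
  1 + y * N * suc N        ∎)
  where
  open ≡-Reasoning
  expand : ∀ d x N → d * (x * N) + 1 * suc N ≡ (1 + x * d) * N + 1
  expand = solve-∀
  regroup : ∀ y N → y * suc N * N + 1 ≡ 1 + y * N * suc N
  regroup = solve-∀

-- Blocks act as reflections

<-or-offset : ∀ m y → y < m ⊎ ∃ λ u → m + u ≡ y
<-or-offset m y with y <? m
... | yes y<m = inj₁ y<m
... | no y≮m  = inj₂ (m≤n⇒∃[o]m+o≡n (≮⇒≥ y≮m))

σ-∷-inside : ∀ c cs {y y′} → suc (y + y′) ≡ 2 * c → σ (c ∷ cs) (suc y) ≡ suc y′
σ-∷-inside c cs {y} {y′} e rewrite sym e | dec-true (suc y ≤? suc (y + y′)) (s≤s (m≤m+n y y′)) =
  trans (cong (_∸ y) (+-assoc y y′ 1)) (trans (m+n∸m≡n y (y′ + 1)) (+-comm y′ 1))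

σ-∷-beyond : ∀ c cs u → σ (c ∷ cs) (suc (2 * c + u)) ≡ 2 * c + σ cs (suc u)
σ-∷-beyond c cs u rewrite dec-false (suc (2 * c + u) ≤? 2 * c) (<⇒≱ (s≤s (m≤m+n (2 * c) u))) =
  cong (λ t → 2 * c + σ cs t) (trans (cong (_∸ 2 * c) (sym (+-suc (2 * c) u))) (m+n∸m≡n (2 * c) (suc u)))

-- Position y is the point suc y; σ cs acts on it as the reflection y ↦ K − 1 − y.
record Mirror (n : ℕ) (cs : List ℕ) (y K : ℕ) : Set where
  constructor mirror
  field
    image    : ℕ
    σ≡       : σ cs (suc y) ≡ suc image
    image<   : image < 2 * n
    reflects : suc (y + image) ≡ K

record MirrorMod (M n : ℕ) (cs : List ℕ) (y K : ℕ) : Set where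
  constructor mirror
  field
    image    : ℕ
    σ≡       : σ cs (suc y) ≡ suc image
    image<   : image < 2 * n
    reflects : suc (y + image) ≡ K [mod M ]

Mirror⇒MirrorMod : ∀ {M n cs y K K′} → K ≡ K′ [mod M ] → Mirror n cs y K → MirrorMod M n cs y K′
Mirror⇒MirrorMod K≡K′ (mirror y′ σy y′< refl) = mirror y′ σy y′< K≡K′

MirrorMod-weaken : ∀ {d M n cs y K K′} → d ∣ M → K ≡ K′ [mod d ] → MirrorMod M n cs y K → MirrorMod d n cs y K′
MirrorMod-weaken d∣M K≡K′ (mirror y′ σy y′< y+y′≡K) = mirror y′ σy y′< (mod-trans (mod-∣ d∣M y+y′≡K) K≡K′)

mirror-head : ∀ {n} c cs {y} → c ≤ n → y < 2 * c → Mirror n (c ∷ cs) y (2 * c)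
mirror-head {n} c cs {y} c≤n y<2c with m≤n⇒∃[o]m+o≡n y<2c
... | y′ , e = mirror y′ (σ-∷-inside c cs e) (<-≤-trans y′<2c (*-monoʳ-≤ 2 c≤n)) e
  where
  y′<2c : y′ < 2 * c
  y′<2c = subst (y′ <_) e (s≤s (m≤n+m y′ y))

mirror-tail : ∀ {n m} c cs {u K} → c + m ≤ n → Mirror m cs u K →
              Mirror n (c ∷ cs) (2 * c + u) (2 * c + (2 * c + K))
mirror-tail {n} {m} c cs {u} c+m≤n (mirror u′ σu u′<2m refl) = mirror (2 * c + u′)
  (trans (σ-∷-beyond c cs u) (trans (cong (2 * c +_) σu) (+-suc (2 * c) u′)))
  (<-≤-trans (subst (2 * c + u′ <_) (sym (*-distribˡ-+ 2 c m)) (+-monoʳ-< (2 * c) u′<2m)) (*-monoʳ-≤ 2 c+m≤n))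
  (regroup c u u′)
  where
  regroup : ∀ c u u′ → suc ((2 * c + u) + (2 * c + u′)) ≡ 2 * c + (2 * c + suc (u + u′))
  regroup = solve-∀

mirror-∘-mirror : ∀ y y₁ y₂ → y₂ + suc (y + y₁) ≡ y + suc (y₁ + y₂)
mirror-∘-mirror = solve-∀

mirror₁ : ∀ n {y} → y < 2 * n → Mirror n (n ∷ []) y (2 * n)
mirror₁ n = mirror-head n [] ≤-refl

mirror₂ : ∀ {n} a {y} → a ≤ n → y < 2 * n → MirrorMod (2 * n) n (a ∷ (n ∸ a) ∷ []) y (2 * a)
mirror₂ {n} a {y} a≤n y<2n with <-or-offset (2 * a) y
... | inj₁ y<2a = Mirror⇒MirrorMod mod-refl (mirror-head a ((n ∸ a) ∷ []) a≤n y<2a)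
... | inj₂ (u , refl) = Mirror⇒MirrorMod K≡2a (mirror-tail a ((n ∸ a) ∷ []) (≤-reflexive (m+[n∸m]≡n a≤n)) (mirror₁ (n ∸ a) u<))
  where
  2n≡2a+2[n∸a] : 2 * n ≡ 2 * a + 2 * (n ∸ a)
  2n≡2a+2[n∸a] = trans (cong (2 *_) (sym (m+[n∸m]≡n a≤n))) (*-distribˡ-+ 2 a (n ∸ a))
  u< : u < 2 * (n ∸ a)
  u< = +-cancelˡ-< (2 * a) u _ (subst (2 * a + u <_) 2n≡2a+2[n∸a] y<2n)
  K≡2a : 2 * a + (2 * a + 2 * (n ∸ a)) ≡ 2 * a [mod 2 * n ]
  K≡2a = mod-trans (mod-reflexive (cong (2 * a +_) (trans (sym 2n≡2a+2[n∸a]) (sym (*-identityˡ _)))))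
                   (+-*-mod (2 * a) 1)

mirror₃ : ∀ a b c {y} → y < 2 * (a + b + c) →
    Mirror (a + b + c) (a ∷ b ∷ c ∷ []) y (2 * a)
  ⊎ (2 * a ≤ y × y < 2 * (a + b)) × Mirror (a + b + c) (a ∷ b ∷ c ∷ []) y (2 * a + (2 * a + 2 * b))
  ⊎ Mirror (a + b + c) (a ∷ b ∷ c ∷ []) y (2 * a + (2 * a + (2 * b + (2 * b + 2 * c))))
mirror₃ a b c {y} y< with <-or-offset (2 * a) y
... | inj₁ y<2a = inj₁ (mirror-head a _ (≤-trans (m≤m+n a b) (m≤m+n (a + b) c)) y<2a)
... | inj₂ (u , refl) with <-or-offset (2 * b) u
...   | inj₁ u<2b = inj₂ (inj₁ ((m≤m+n (2 * a) u , 2a+u<2[a+b]) ,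
        mirror-tail a _ a+[b+c]≤n (mirror-head {b + c} b (c ∷ []) (m≤m+n b c) u<2b)))
  where
  2a+u<2[a+b] : 2 * a + u < 2 * (a + b)
  2a+u<2[a+b] = subst (2 * a + u <_) (sym (*-distribˡ-+ 2 a b)) (+-monoʳ-< (2 * a) u<2b)
  a+[b+c]≤n : a + (b + c) ≤ a + b + c
  a+[b+c]≤n = ≤-reflexive (sym (+-assoc a b c))
...   | inj₂ (v , refl) = inj₂ (inj₂
        (mirror-tail a _ a+[b+c]≤n (mirror-tail b (c ∷ []) ≤-refl (mirror₁ c v<2c))))
  where
  a+[b+c]≤n : a + (b + c) ≤ a + b + c
  a+[b+c]≤n = ≤-reflexive (sym (+-assoc a b c))
  expand : ∀ a b c → 2 * (a + b + c) ≡ 2 * a + (2 * b + 2 * c)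
  expand = solve-∀
  v<2c : v < 2 * c
  v<2c = +-cancelˡ-< (2 * b) v _ (+-cancelˡ-< (2 * a) _ _ (subst (2 * a + (2 * b + v) <_) (expand a b c) y<))

-- Criteria for (non-)transitivity

ReflectsMod : ℕ → ℕ → List ℕ → ℕ → Set
ReflectsMod M n cs K = ∀ y → y < 2 * n → MirrorMod M n cs y K

reach-trans : ∀ {c⁺ c⁻ i j k} → Reach c⁺ c⁻ i j → Reach c⁺ c⁻ j k → Reach c⁺ c⁻ i k
reach-trans p here      = p
reach-trans p (step⁺ q) = step⁺ (reach-trans p q)
reach-trans p (step⁻ q) = step⁻ (reach-trans p q)

reach-σ⁺ : ∀ {c⁺ c⁻ i j} → σ c⁺ i ≡ j → Reach c⁺ c⁻ i j
reach-σ⁺ σ≡ = subst (Reach _ _ _) σ≡ (step⁺ here)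

reach-σ⁻ : ∀ {c⁺ c⁻ i j} → σ c⁻ i ≡ j → Reach c⁺ c⁻ i j
reach-σ⁻ σ≡ = subst (Reach _ _ _) σ≡ (step⁻ here)

module MirrorInvariant {c⁺ c⁻ : List ℕ} {M n K : ℕ}
  (reflects⁺ : ReflectsMod M n c⁺ K) (reflects⁻ : ReflectsMod M n c⁻ K) where

  Orbit : ℕ → ℕ → Set
  Orbit x z = z ≡ x [mod M ] ⊎ suc (x + z) ≡ K [mod M ]

  orbit-reflect : ∀ {x z z′} → Orbit x z → suc (z + z′) ≡ K [mod M ] → Orbit x z′
  orbit-reflect {x} {z} {z′} (inj₁ z≡x) z+z′≡K = inj₂ (begin
    suc (x + z′)  ≡⟨ +-suc x z′ ⟨
    x + suc z′    ≈⟨ +-mod z≡x (mod-refl {a = suc z′}) ⟨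
    z + suc z′    ≡⟨ +-suc z z′ ⟩
    suc (z + z′)  ≈⟨ z+z′≡K ⟩
    K             ∎)
    where open ≡-mod-Reasoning M
  orbit-reflect {x} {z} {z′} (inj₂ x+z≡K) z+z′≡K = inj₁ (+-cancelʳ-mod (suc z) (begin
    z′ + suc z    ≡⟨ trans (+-suc z′ z) (cong suc (+-comm z′ z)) ⟩
    suc (z + z′)  ≈⟨ z+z′≡K ⟩
    K             ≈⟨ x+z≡K ⟨
    suc (x + z)   ≡⟨ +-suc x z ⟨
    x + suc z     ∎))
    where open ≡-mod-Reasoning M

  orbit : ∀ {x j} → x < 2 * n → Reach c⁺ c⁻ (suc x) j → ∃ λ z → j ≡ suc z × z < 2 * n × Orbit x z
  orbit x< here = _ , refl , x< , inj₁ mod-refl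
  orbit x< (step⁺ r) with orbit x< r
  ... | z , refl , z< , o with reflects⁺ z z<
  ...   | mirror z′ σ≡ z′< z+z′≡K = z′ , σ≡ , z′< , orbit-reflect o z+z′≡K
  orbit x< (step⁻ r) with orbit x< r
  ... | z , refl , z< , o with reflects⁻ z z<
  ...   | mirror z′ σ≡ z′< z+z′≡K = z′ , σ≡ , z′< , orbit-reflect o z+z′≡K

  not-transitive : 4 ≤ M → 2 ≤ n → ¬ Transitive n c⁺ c⁻
  not-transitive 4≤M 2≤n T = excluded (orbit 0<2n (T 1 2 (s≤s z≤n) 0<2n (s≤s z≤n) 2≤2n))
                                      (orbit 0<2n (T 1 3 (s≤s z≤n) 0<2n (s≤s z≤n) 3≤2n))
    where
    2≤2n : 2 ≤ 2 * n
    2≤2n = ≤-trans 2≤n (m≤m+n n (n + 0))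
    0<2n : 0 < 2 * n
    0<2n = ≤-trans (s≤s z≤n) 2≤2n
    3≤2n : 3 ≤ 2 * n
    3≤2n = ≤-trans (s≤s (s≤s (s≤s (z≤n {1})))) (*-monoʳ-≤ 2 2≤n)
    distinct : ∀ {a b} → a < 4 → b < 4 → a ≢ b → ¬ a ≡ b [mod M ]
    distinct a<4 b<4 a≢b a≡b = a≢b (mod-<⇒≡ (<-≤-trans a<4 4≤M) (<-≤-trans b<4 4≤M) a≡b)
    excluded : (∃ λ z → 2 ≡ suc z × z < 2 * n × Orbit 0 z) → (∃ λ z → 3 ≡ suc z × z < 2 * n × Orbit 0 z) → ⊥
    excluded (_ , refl , _ , inj₁ 1≡0) _ = distinct (s≤s (s≤s z≤n)) (s≤s z≤n) (λ ()) 1≡0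
    excluded _ (_ , refl , _ , inj₁ 2≡0) = distinct (s≤s (s≤s (s≤s z≤n))) (s≤s z≤n) (λ ()) 2≡0
    excluded (_ , refl , _ , inj₂ 2≡K) (_ , refl , _ , inj₂ 3≡K) =
      distinct (s≤s (s≤s (s≤s z≤n))) ≤-refl (λ ()) (mod-trans 2≡K (mod-sym 3≡K))

-- The 2 N positions form a circle whose first 2 n positions are the points themselves
-- (P y = suc y), and along which the generators can move by 2 d.
module TranslationCriterion {c⁺ c⁻ : List ℕ} {n N d : ℕ} (P : ℕ → ℕ)
  (n≤N : n ≤ N) (1≤n : 1 ≤ n) (coprime : gcd d N ≡ 1)
  (P-id : ∀ y → y < 2 * n → P y ≡ suc y)
  (translate : ∀ y → y < 2 * N →
     ∃ λ y′ → y′ < 2 * N × (y′ ≡ y + 2 * d [mod 2 * N ]) × Reach c⁺ c⁻ (P y) (P y′))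
  (reflects⁻ : ReflectsMod 2 n c⁻ 0) where

  translate-iterate : ∀ k x → x < 2 * N →
    ∃ λ y → y < 2 * N × (y ≡ x + k * (2 * d) [mod 2 * N ]) × Reach c⁺ c⁻ (P x) (P y)
  translate-iterate zero x x< = x , x< , mod-reflexive (sym (+-identityʳ x)) , here
  translate-iterate (suc k) x x< with translate-iterate k x x<
  ... | y , y< , y≡ , r with translate y y<
  ...   | y′ , y′< , y′≡ , r′ =
    y′ , y′< , mod-trans y′≡ (mod-trans (+-mod y≡ mod-refl) (mod-reflexive (regroup x k d))) , reach-trans r r′
    where
    regroup : ∀ x k d → x + k * (2 * d) + 2 * d ≡ x + (1 + k) * (2 * d)
    regroup = solve-∀

  <2n⇒<2N : ∀ {x} → x < 2 * n → x < 2 * N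
  <2n⇒<2N x< = <-≤-trans x< (*-monoʳ-≤ 2 n≤N)

  reach-even-gap : ∀ x z → x < 2 * n → z < 2 * n → Even (x + z) → Reach c⁺ c⁻ (suc x) (suc z)
  reach-even-gap x z x< z< x+z-even
    with even-gap {N} {x} {z} (<⇒≤ (<2n⇒<2N x<)) x+z-even | coprime⇒inverse {d} {N} (≤-trans 1≤n n≤N) coprime
  ... | e , x+2e≡z | u , du≡1 with translate-iterate (u * e) x (<2n⇒<2N x<)
  ...   | y , y< , y≡ , r = subst₂ (Reach c⁺ c⁻) (P-id x x<) (trans (cong P y≡z) (P-id z z<)) r
    where
    open ≡-mod-Reasoning (2 * N)
    regroup : ∀ x u e d → x + u * e * (2 * d) ≡ x + e * (2 * (d * u))
    regroup = solve-∀
    y≡z : y ≡ z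
    y≡z = mod-<⇒≡ y< (<2n⇒<2N z<) (begin
      y                          ≈⟨ y≡ ⟩
      x + u * e * (2 * d)        ≡⟨ regroup x u e d ⟩
      x + e * (2 * (d * u))      ≈⟨ +-mod (mod-refl {a = x}) (*-congˡ-mod e (*-mod-* {N} 2 du≡1)) ⟩
      x + e * 2                  ≡⟨ cong (x +_) (*-comm e 2) ⟩
      x + 2 * e                  ≈⟨ x+2e≡z ⟩
      z                          ∎)

  transitive : Transitive n c⁺ c⁻
  transitive (suc x) (suc z) _ x< _ z< with even-or-odd (x + z)
  ... | inj₁ even = reach-even-gap x z x< z< even
  ... | inj₂ odd with reflects⁻ x x<
  ...   | mirror x′ σ≡ x′< x+x′-odd = reach-trans (reach-σ⁻ σ≡) (reach-even-gap x′ z x′< z< x′+z-even)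
    where
    regroup : ∀ x x′ z → suc (x + x′) + suc (x + z) ≡ (x′ + z) + suc x * 2
    regroup = solve-∀
    x′+z-even : Even (x′ + z)
    x′+z-even = begin
      x′ + z                         ≈⟨ +-*-mod (x′ + z) (suc x) ⟨
      (x′ + z) + suc x * 2           ≡⟨ regroup x x′ z ⟨
      suc (x + x′) + suc (x + z)     ≈⟨ +-mod x+x′-odd odd ⟩
      0                              ∎
      where open ≡-mod-Reasoning 2

reflections-translate : ∀ {n c⁺ c⁻ K₁ K₂ d} → ReflectsMod (2 * n) n c⁺ K₁ → ReflectsMod (2 * n) n c⁻ K₂ →
  K₂ ≡ 2 * d + K₁ [mod 2 * n ] → ∀ y → y < 2 * n →
  ∃ λ y′ → y′ < 2 * n × (y′ ≡ y + 2 * d [mod 2 * n ]) × Reach c⁺ c⁻ (suc y) (suc y′)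
reflections-translate {n} {K₁ = K₁} {d = d} reflects⁺ reflects⁻ K₂≡ y y< with reflects⁺ y y<
... | mirror y₁ σ⁺≡ y₁< y+y₁≡K₁ with reflects⁻ y₁ y₁<
...   | mirror y₂ σ⁻≡ y₂< y₁+y₂≡K₂ =
  y₂ , y₂< , +-cancelʳ-mod K₁ y₂+K₁≡ , reach-trans (reach-σ⁺ σ⁺≡) (reach-σ⁻ σ⁻≡)
  where
  open ≡-mod-Reasoning (2 * n)
  y₂+K₁≡ : y₂ + K₁ ≡ (y + 2 * d) + K₁ [mod 2 * n ]
  y₂+K₁≡ = begin
    y₂ + K₁            ≈⟨ +-mod (mod-refl {a = y₂}) y+y₁≡K₁ ⟨
    y₂ + suc (y + y₁)  ≡⟨ mirror-∘-mirror y y₁ y₂ ⟩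
    y + suc (y₁ + y₂)  ≈⟨ +-mod (mod-refl {a = y}) (mod-trans y₁+y₂≡K₂ K₂≡) ⟩
    y + (2 * d + K₁)   ≡⟨ +-assoc y (2 * d) K₁ ⟨
    (y + 2 * d) + K₁   ∎

-- Transitivity for the three shapes

transitive₂₁⇔coprime : ∀ {n a} → 1 ≤ a → a < n → Transitive n (a ∷ (n ∸ a) ∷ []) (n ∷ []) ⇔ gcd a n ≡ 1
transitive₂₁⇔coprime {n} {a} 1≤a a<n = mk⇔ coprime transitive
  where
  a≤n : a ≤ n
  a≤n = <⇒≤ a<n
  g : ℕ
  g = gcd a n

  coprime : Transitive n (a ∷ (n ∸ a) ∷ []) (n ∷ []) → g ≡ 1
  coprime T = decidable-stable (g ≟ 1) λ g≢1 → MirrorInvariant.not-transitive {M = 2 * g} {K = 0}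
    (λ _ y< → MirrorMod-weaken (*-monoʳ-∣ 2 (gcd[m,n]∣n a n)) (∣⇒2*≡0-mod (gcd[m,n]∣m a n)) (mirror₂ a a≤n y<))
    (λ _ y< → Mirror⇒MirrorMod (∣⇒2*≡0-mod (gcd[m,n]∣n a n)) (mirror₁ n y<))
    (*-monoʳ-≤ 2 (gcd≢1⇒2≤gcd 1≤a g≢1)) (≤-trans (s≤s 1≤a) a<n) T

  transitive : g ≡ 1 → Transitive n (a ∷ (n ∸ a) ∷ []) (n ∷ [])
  transitive g≡1 = TranslationCriterion.transitive {d = n ∸ a} suc ≤-refl (≤-trans 1≤a a≤n)
    (trans (gcd[n∸m,n]≡gcd[m,n] a≤n) g≡1) (λ _ _ → refl)
    (reflections-translate {d = n ∸ a} (λ _ → mirror₂ a a≤n) (λ _ y< → Mirror⇒MirrorMod mod-refl (mirror₁ n y<))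
      (mod-reflexive 2n≡2[n∸a]+2a))
    (λ _ y< → Mirror⇒MirrorMod (∣⇒≡0-mod (m∣m*n n)) (mirror₁ n y<))
    where
    2n≡2[n∸a]+2a : 2 * n ≡ 2 * (n ∸ a) + 2 * a
    2n≡2[n∸a]+2a = trans (cong (2 *_) (sym (m∸n+n≡m a≤n))) (*-distribˡ-+ 2 (n ∸ a) a)

transitive₂₂⇔coprime : ∀ {n a b} → 1 ≤ a → a < n → 1 ≤ b → b < n →
  Transitive n (a ∷ (n ∸ a) ∷ []) (b ∷ (n ∸ b) ∷ []) ⇔ gcd (b + (n ∸ a)) n ≡ 1
transitive₂₂⇔coprime {n} {a} {b} 1≤a a<n 1≤b b<n = mk⇔ coprime transitive
  where
  a≤n : a ≤ n
  a≤n = <⇒≤ a<n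
  b≤n : b ≤ n
  b≤n = <⇒≤ b<n
  D g : ℕ
  D = b + (n ∸ a)
  g = gcd D n

  2D+2a≡2b+2n : 2 * D + 2 * a ≡ 2 * b + 1 * (2 * n)
  2D+2a≡2b+2n = trans (regroup b (n ∸ a) a) (cong (λ t → 2 * b + 1 * (2 * t)) (m∸n+n≡m a≤n))
    where
    regroup : ∀ b x a → 2 * (b + x) + 2 * a ≡ 2 * b + 1 * (2 * (x + a))
    regroup = solve-∀

  2b≡2D+2a : 2 * b ≡ 2 * D + 2 * a [mod 2 * n ]
  2b≡2D+2a = mod-sym (mod-trans (mod-reflexive 2D+2a≡2b+2n) (+-*-mod (2 * b) 1))

  coprime : Transitive n (a ∷ (n ∸ a) ∷ []) (b ∷ (n ∸ b) ∷ []) → g ≡ 1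
  coprime T = decidable-stable (g ≟ 1) λ g≢1 → MirrorInvariant.not-transitive {M = 2 * g} {K = 2 * a}
    (λ _ y< → MirrorMod-weaken 2g∣2n mod-refl (mirror₂ a a≤n y<))
    (λ _ y< → MirrorMod-weaken 2g∣2n 2b≡2a (mirror₂ b b≤n y<))
    (*-monoʳ-≤ 2 (gcd≢1⇒2≤gcd (≤-trans 1≤b (m≤m+n b (n ∸ a))) g≢1)) (≤-trans (s≤s 1≤a) a<n) T
    where
    2g∣2n : 2 * g ∣ 2 * n
    2g∣2n = *-monoʳ-∣ 2 (gcd[m,n]∣n D n)
    2b≡2a : 2 * b ≡ 2 * a [mod 2 * g ]
    2b≡2a = mod-trans (mod-∣ 2g∣2n 2b≡2D+2a) (+-mod (∣⇒2*≡0-mod (gcd[m,n]∣m D n)) mod-refl)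

  transitive : g ≡ 1 → Transitive n (a ∷ (n ∸ a) ∷ []) (b ∷ (n ∸ b) ∷ [])
  transitive g≡1 = TranslationCriterion.transitive {d = D} suc ≤-refl (≤-trans 1≤a a≤n) g≡1 (λ _ _ → refl)
    (reflections-translate {d = D} (λ _ → mirror₂ a a≤n) (λ _ → mirror₂ b b≤n) 2b≡2D+2a)
    (λ _ y< → MirrorMod-weaken (m∣m*n n) (∣⇒≡0-mod (m∣m*n b)) (mirror₂ b b≤n y<))

module Shape₃₁ (a b c : ℕ) where

  n N : ℕ
  n = a + b + c
  N = n + b

  c⁺ c⁻ : List ℕ
  c⁺ = a ∷ b ∷ c ∷ []
  c⁻ = n ∷ []

  -- Positions 2 n ≤ y < 2 N of the circle are copies of the points 2 c < j ≤ 2 (b + c).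
  P : ℕ → ℕ
  P y = if does (y <? 2 * n) then suc y else suc (y ∸ 2 * (a + b))

  P-id : ∀ y → y < 2 * n → P y ≡ suc y
  P-id y y< rewrite dec-true (y <? 2 * n) y< = refl

  P-beyond : ∀ y → 2 * n ≤ y → P y ≡ suc (y ∸ 2 * (a + b))
  P-beyond y 2n≤y rewrite dec-false (y <? 2 * n) (≤⇒≯ 2n≤y) = refl

  2n≡2a+2[b+c] : 2 * n ≡ 2 * a + 2 * (b + c)
  2n≡2a+2[b+c] = expand a b c
    where
    expand : ∀ a b c → 2 * (a + b + c) ≡ 2 * a + 2 * (b + c)
    expand = solve-∀

  2N≡2[a+b]+2[b+c] : 2 * N ≡ 2 * (a + b) + 2 * (b + c)
  2N≡2[a+b]+2[b+c] = expand a b c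
    where
    expand : ∀ a b c → 2 * (a + b + c + b) ≡ 2 * (a + b) + 2 * (b + c)
    expand = solve-∀

  <2n⇒<2N : ∀ {y} → y < 2 * n → y < 2 * N
  <2n⇒<2N y< = <-≤-trans y< (*-monoʳ-≤ 2 (m≤m+n n b))

  Translates : ℕ → Set
  Translates y = ∃ λ y′ → y′ < 2 * N × (y′ ≡ y + 2 * (b + c) [mod 2 * N ]) × Reach c⁺ c⁻ (P y) (P y′)

  through-mirrors : ∀ {y K} → Mirror n c⁺ y K →
    ∃ λ y₂ → y₂ < 2 * n × y₂ + K ≡ y + 2 * n × Reach c⁺ c⁻ (suc y) (suc y₂)
  through-mirrors {y} (mirror y₁ σ⁺≡ y₁< refl) with mirror₁ n y₁<
  ... | mirror y₂ σ⁻≡ y₂< y₁+y₂≡2n = y₂ , y₂< , trans (mirror-∘-mirror y y₁ y₂) (cong (y +_) y₁+y₂≡2n) ,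
        reach-trans (reach-σ⁺ σ⁺≡) (reach-σ⁻ σ⁻≡)

  translate-block₁ : ∀ {y y₂} → y < 2 * n → y₂ < 2 * n → y₂ + 2 * a ≡ y + 2 * n →
    Reach c⁺ c⁻ (suc y) (suc y₂) → Translates y
  translate-block₁ {y} {y₂} y< y₂< eq r =
    y₂ , <2n⇒<2N y₂< , mod-reflexive y₂≡ , subst₂ (Reach c⁺ c⁻) (sym (P-id y y<)) (sym (P-id y₂ y₂<)) r
    where
    regroup : ∀ y a d → y + (2 * a + d) ≡ (y + d) + 2 * a
    regroup = solve-∀
    y₂≡ : y₂ ≡ y + 2 * (b + c)
    y₂≡ = +-cancelʳ-≡ (2 * a) _ _ (trans eq (trans (cong (y +_) 2n≡2a+2[b+c]) (regroup y a (2 * (b + c)))))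

  translate-block₂ : ∀ {y y₂} → 2 * a ≤ y → y < 2 * (a + b) → y₂ + (2 * a + (2 * a + 2 * b)) ≡ y + 2 * n →
    Reach c⁺ c⁻ (suc y) (suc y₂) → Translates y
  translate-block₂ {y} {y₂} 2a≤y y< eq r = y + 2 * (b + c) , y′<2N , mod-refl ,
    subst₂ (Reach c⁺ c⁻) (sym (P-id y (<-≤-trans y< (*-monoʳ-≤ 2 (m≤m+n (a + b) c))))) (sym P[y′]≡) r
    where
    regroupˡ : ∀ y₂ a b → y₂ + (2 * a + (2 * a + 2 * b)) ≡ (y₂ + 2 * (a + b)) + 2 * a
    regroupˡ = solve-∀
    regroupʳ : ∀ y a b c → y + 2 * (a + b + c) ≡ (y + 2 * (b + c)) + 2 * a
    regroupʳ = solve-∀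
    y′≡ : y₂ + 2 * (a + b) ≡ y + 2 * (b + c)
    y′≡ = +-cancelʳ-≡ (2 * a) _ _ (trans (sym (regroupˡ y₂ a b)) (trans eq (regroupʳ y a b c)))
    y′<2N : y + 2 * (b + c) < 2 * N
    y′<2N = subst (y + 2 * (b + c) <_) (sym 2N≡2[a+b]+2[b+c]) (+-monoˡ-< (2 * (b + c)) y<)
    2n≤y′ : 2 * n ≤ y + 2 * (b + c)
    2n≤y′ = subst (_≤ y + 2 * (b + c)) (sym 2n≡2a+2[b+c]) (+-monoˡ-≤ (2 * (b + c)) 2a≤y)
    P[y′]≡ : P (y + 2 * (b + c)) ≡ suc y₂
    P[y′]≡ = trans (P-beyond _ 2n≤y′) (cong suc (trans (cong (_∸ 2 * (a + b)) (sym y′≡)) (m+n∸n≡m y₂ (2 * (a + b)))))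

  translate-block₃ : ∀ {y y₂} → y < 2 * n → y₂ < 2 * n → y₂ + (2 * a + (2 * a + (2 * b + (2 * b + 2 * c)))) ≡ y + 2 * n →
    Reach c⁺ c⁻ (suc y) (suc y₂) → Translates y
  translate-block₃ {y} {y₂} y< y₂< eq r = y₂ , <2n⇒<2N y₂< , (1 , 0 , y₂≡) ,
    subst₂ (Reach c⁺ c⁻) (sym (P-id y y<)) (sym (P-id y₂ y₂<)) r
    where
    regroup : ∀ y₂ a b c → y₂ + (2 * a + (2 * a + (2 * b + (2 * b + 2 * c)))) ≡ (y₂ + 2 * (a + b)) + 2 * (a + b + c)
    regroup = solve-∀
    y₂+2[a+b]≡y : y₂ + 2 * (a + b) ≡ y
    y₂+2[a+b]≡y = +-cancelʳ-≡ (2 * n) _ _ (trans (sym (regroup y₂ a b c)) eq)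
    regroup′ : ∀ y₂ A D → y₂ + 1 * (A + D) ≡ (y₂ + A) + D + 0
    regroup′ = solve-∀
    y₂≡ : y₂ + 1 * (2 * N) ≡ y + 2 * (b + c) + 0 * (2 * N)
    y₂≡ = trans (cong (λ t → y₂ + 1 * t) 2N≡2[a+b]+2[b+c])
      (trans (regroup′ y₂ (2 * (a + b)) (2 * (b + c))) (cong (λ t → t + 2 * (b + c) + 0) y₂+2[a+b]≡y))

  translate-beyond : ∀ u → 2 * n + u < 2 * N → Translates (2 * n + u)
  translate-beyond u y< =
    u + 2 * c , <2n⇒<2N u+2c<2n , (1 , 0 , regroup a b c u) , subst (Reach c⁺ c⁻ (P (2 * n + u))) P≡ here
    where
    regroup : ∀ a b c u →
      u + 2 * c + 1 * (2 * (a + b + c + b)) ≡ 2 * (a + b + c) + u + 2 * (b + c) + 0 * (2 * (a + b + c + b))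
    regroup = solve-∀
    u<2b : u < 2 * b
    u<2b = +-cancelˡ-< (2 * n) u (2 * b) (subst (2 * n + u <_) (*-distribˡ-+ 2 n b) y<)
    bound : ∀ a b c → 2 * b + 2 * c ≤ 2 * (a + b + c)
    bound a b c = subst (2 * b + 2 * c ≤_) (regroup′ a b c) (m≤n+m (2 * b + 2 * c) (2 * a))
      where
      regroup′ : ∀ a b c → 2 * a + (2 * b + 2 * c) ≡ 2 * (a + b + c)
      regroup′ = solve-∀
    u+2c<2n : u + 2 * c < 2 * n
    u+2c<2n = <-≤-trans (+-monoˡ-< (2 * c) u<2b) (bound a b c)
    shift : ∀ a b c u → 2 * (a + b + c) + u ≡ 2 * (a + b) + (u + 2 * c)
    shift = solve-∀
    P≡ : P (2 * n + u) ≡ P (u + 2 * c)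
    P≡ = trans (P-beyond _ (m≤m+n (2 * n) u))
      (trans (cong suc (trans (cong (_∸ 2 * (a + b)) (shift a b c u)) (m+n∸m≡n (2 * (a + b)) (u + 2 * c))))
        (sym (P-id _ u+2c<2n)))

  translate : ∀ y → y < 2 * N → Translates y
  translate y y<2N with <-or-offset (2 * n) y
  ... | inj₂ (u , refl) = translate-beyond u y<2N
  ... | inj₁ y<2n with mirror₃ a b c y<2n
  ...   | inj₁ m⁺ with through-mirrors m⁺
  ...     | _ , y₂< , eq , r = translate-block₁ y<2n y₂< eq r
  translate y y<2N | inj₁ y<2n | inj₂ (inj₁ ((2a≤y , y<) , m⁺)) with through-mirrors m⁺
  ...     | _ , _ , eq , r = translate-block₂ 2a≤y y< eq r
  translate y y<2N | inj₁ y<2n | inj₂ (inj₂ m⁺) with through-mirrors m⁺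
  ...     | _ , y₂< , eq , r = translate-block₃ y<2n y₂< eq r

  transitive : 1 ≤ a → gcd (a + b) (b + c) ≡ 1 → Transitive n c⁺ c⁻
  transitive 1≤a g≡1 = TranslationCriterion.transitive {d = b + c} P (m≤m+n n b) 1≤n coprime P-id translate
    (λ _ y< → Mirror⇒MirrorMod (∣⇒≡0-mod (m∣m*n n)) (mirror₁ n y<))
    where
    regroup : ∀ a b c → a + b + c + b ≡ (b + c) + (a + b)
    regroup = solve-∀
    1≤n : 1 ≤ n
    1≤n = ≤-trans 1≤a (≤-trans (m≤m+n a b) (m≤m+n (a + b) c))
    coprime : gcd (b + c) N ≡ 1
    coprime = trans (cong (gcd (b + c)) (regroup a b c))
      (trans (gcd[m,m+n]≡gcd[m,n] (b + c) (a + b)) (trans (gcd-comm (b + c) (a + b)) g≡1))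

  not-transitive : 1 ≤ a → 1 ≤ b → gcd (a + b) (b + c) ≢ 1 → ¬ Transitive n c⁺ c⁻
  not-transitive 1≤a 1≤b g≢1 = MirrorInvariant.not-transitive {M = 2 * g} {K = 2 * a} reflects⁺ reflects⁻
    (*-monoʳ-≤ 2 (gcd≢1⇒2≤gcd (≤-trans 1≤a (m≤m+n a b)) g≢1)) (≤-trans (+-mono-≤ 1≤a 1≤b) (m≤m+n (a + b) c))
    where
    g : ℕ
    g = gcd (a + b) (b + c)
    2[a+b]≡0 : 2 * (a + b) ≡ 0 [mod 2 * g ]
    2[a+b]≡0 = ∣⇒2*≡0-mod (gcd[m,n]∣m (a + b) (b + c))
    2[b+c]≡0 : 2 * (b + c) ≡ 0 [mod 2 * g ]
    2[b+c]≡0 = ∣⇒2*≡0-mod (gcd[m,n]∣n (a + b) (b + c))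
    regroup₂ : ∀ a b → 2 * a + (2 * a + 2 * b) ≡ 2 * a + 2 * (a + b)
    regroup₂ = solve-∀
    regroup₃ : ∀ a b c → 2 * a + (2 * a + (2 * b + (2 * b + 2 * c))) ≡ 2 * a + (2 * (a + b) + 2 * (b + c))
    regroup₃ = solve-∀
    reflects⁺ : ReflectsMod (2 * g) n c⁺ (2 * a)
    reflects⁺ y y< with mirror₃ a b c y<
    ... | inj₁ m = Mirror⇒MirrorMod mod-refl m
    ... | inj₂ (inj₁ (_ , m)) = Mirror⇒MirrorMod (mod-trans (mod-reflexive (regroup₂ a b)) (+-≡0-mod 2[a+b]≡0)) m
    ... | inj₂ (inj₂ m) = Mirror⇒MirrorMod
      (mod-trans (mod-reflexive (regroup₃ a b c)) (+-≡0-mod (+-mod 2[a+b]≡0 2[b+c]≡0))) m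
    reflects⁻ : ReflectsMod (2 * g) n c⁻ (2 * a)
    reflects⁻ y y< = Mirror⇒MirrorMod (mod-trans (mod-reflexive 2n≡2a+2[b+c]) (+-≡0-mod 2[b+c]≡0)) (mirror₁ n y<)

transitive₃₁⇔coprime : ∀ {a b c} → 1 ≤ a → 1 ≤ b →
  Transitive (a + b + c) (a ∷ b ∷ c ∷ []) ((a + b + c) ∷ []) ⇔ gcd (a + b) (b + c) ≡ 1
transitive₃₁⇔coprime {a} {b} {c} 1≤a 1≤b = mk⇔ coprime (Shape₃₁.transitive a b c 1≤a)
  where
  coprime : Transitive (a + b + c) (a ∷ b ∷ c ∷ []) ((a + b + c) ∷ []) → gcd (a + b) (b + c) ≡ 1
  coprime T = decidable-stable (gcd (a + b) (b + c) ≟ 1) λ g≢1 → Shape₃₁.not-transitive a b c 1≤a 1≤b g≢1 T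

-- Counting along intervals

range : ℕ → ℕ → List ℕ
range u zero    = []
range u (suc k) = u ∷ range (suc u) k

length-range : ∀ u k → length (range u k) ≡ k
length-range u zero    = refl
length-range u (suc k) = cong suc (length-range (suc u) k)

∈-range⁻ : ∀ {x} u k → x ∈ range u k → u ≤ x × x < u + k
∈-range⁻ u (suc k) (here refl) = ≤-refl , subst (u <_) (sym (+-suc u k)) (s≤s (m≤m+n u k))
∈-range⁻ {x} u (suc k) (there x∈) with ∈-range⁻ (suc u) k x∈
... | u<x , x< = <⇒≤ u<x , subst (x <_) (sym (+-suc u k)) x<

∈-range⁺ : ∀ {x} u k → u ≤ x → x < u + k → x ∈ range u k
∈-range⁺ {x} u zero u≤x x< = contradiction (subst (_≤ x) (sym (+-identityʳ u)) u≤x) (<⇒≱ x<)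
∈-range⁺ {x} u (suc k) u≤x x< with u ≟ x
... | yes refl = here refl
... | no u≢x   = there (∈-range⁺ (suc u) k (≤∧≢⇒< u≤x u≢x) (subst (x <_) (+-suc u k) x<))

range-unique : ∀ u k → Unique (range u k)
range-unique u zero    = []
range-unique u (suc k) =
  All.tabulate (λ y∈ u≡y → <⇒≢ (proj₁ (∈-range⁻ (suc u) k y∈)) u≡y) ∷ range-unique (suc u) k

range-++ : ∀ u k l → range u (k + l) ≡ range u k ++ range (u + k) l
range-++ u zero    l = cong (λ v → range v l) (sym (+-identityʳ u))
range-++ u (suc k) l =
  cong (u ∷_) (trans (range-++ (suc u) k l) (cong (λ v → range (suc u) k ++ range v l) (sym (+-suc u k))))

range-∷ʳ : ∀ u k → range u (suc k) ≡ range u k ++ [ u + k ]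
range-∷ʳ u k = trans (cong (range u) (+-comm 1 k)) (range-++ u k 1)

map-+-range : ∀ v u k → map (_+ v) (range u k) ≡ range (u + v) k
map-+-range v u zero    = refl
map-+-range v u (suc k) = cong (u + v ∷_) (map-+-range v (suc u) k)

map-suc-upTo : ∀ m → map suc (upTo m) ≡ range 1 m
map-suc-upTo zero    = refl
map-suc-upTo (suc m) = begin
  map suc (upTo (suc m))        ≡⟨ cong (map suc) (sym (applyUpTo-∷ʳ (λ i → i) m)) ⟩
  map suc (upTo m ++ [ m ])     ≡⟨ map-++ suc (upTo m) [ m ] ⟩
  map suc (upTo m) ++ [ suc m ] ≡⟨ cong (_++ [ suc m ]) (map-suc-upTo m) ⟩
  range 1 m ++ [ 1 + m ]        ≡⟨ sym (range-∷ʳ 1 m) ⟩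
  range 1 (suc m)               ∎
  where open ≡-Reasoning

module _ {A : Set} where

  count : {P : A → Set} → Decidable P → List A → ℕ
  count P? xs = length (filter P? xs)

  count-++ : ∀ {P : A → Set} (P? : Decidable P) xs ys → count P? (xs ++ ys) ≡ count P? xs + count P? ys
  count-++ P? xs ys = trans (cong length (filter-++ P? xs ys)) (length-++ (filter P? xs))

  count-none : ∀ {P : A → Set} (P? : Decidable P) xs → (∀ x → x ∈ xs → ¬ P x) → count P? xs ≡ 0
  count-none P? xs none = cong length (filter-none P? (All.tabulate (none _)))

  count-[]-cong : ∀ {P Q : A → Set} (P? : Decidable P) (Q? : Decidable Q) x y → P x ⇔ Q y →
                  count P? [ x ] ≡ count Q? [ y ]
  count-[]-cong P? Q? x y Px⇔Qy with P? x | Q? y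
  ... | yes _  | yes _  = refl
  ... | no _   | no _   = refl
  ... | yes Px | no ¬Qy = contradiction (Equivalence.to Px⇔Qy Px) ¬Qy
  ... | no ¬Px | yes Qy = contradiction (Equivalence.from Px⇔Qy Qy) ¬Px

  count-cong-∈ : ∀ {P Q : A → Set} (P? : Decidable P) (Q? : Decidable Q) xs →
                 (∀ x → x ∈ xs → P x ⇔ Q x) → count P? xs ≡ count Q? xs
  count-cong-∈ P? Q? []       _     = refl
  count-cong-∈ P? Q? (x ∷ xs) P⇔Q = begin
    count P? ([ x ] ++ xs)          ≡⟨ count-++ P? [ x ] xs ⟩
    count P? [ x ] + count P? xs    ≡⟨ cong₂ _+_ (count-[]-cong P? Q? x x (P⇔Q x (here refl)))
                                         (count-cong-∈ P? Q? xs (λ y y∈ → P⇔Q y (there y∈))) ⟩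
    count Q? [ x ] + count Q? xs    ≡⟨ sym (count-++ Q? [ x ] xs) ⟩
    count Q? ([ x ] ++ xs)          ∎
    where open ≡-Reasoning

  sum-count-[] : ∀ {P : A → Set} (P? : Decidable P) xs → sum (map (λ x → count P? [ x ]) xs) ≡ count P? xs
  sum-count-[] P? []       = refl
  sum-count-[] P? (x ∷ xs) = sym (trans (count-++ P? [ x ] xs) (cong (count P? [ x ] +_) (sym (sum-count-[] P? xs))))

  sum-map-+ : ∀ (f g h : A → ℕ) xs → (∀ x → x ∈ xs → f x + g x ≡ h x) →
              sum (map f xs) + sum (map g xs) ≡ sum (map h xs)
  sum-map-+ f g h []       _  = refl
  sum-map-+ f g h (x ∷ xs) eq = trans (interchange (f x) (g x) (sum (map f xs)) (sum (map g xs)))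
    (cong₂ _+_ (eq x (here refl)) (sum-map-+ f g h xs (λ y y∈ → eq y (there y∈))))
    where
    interchange : ∀ a b c d → a + c + (b + d) ≡ a + b + (c + d)
    interchange = solve-∀

  sum-map-const : ∀ k (xs : List A) → sum (map (λ _ → k) xs) ≡ length xs * k
  sum-map-const k []       = refl
  sum-map-const k (x ∷ xs) = cong (k +_) (sum-map-const k xs)

count-map : ∀ {A B : Set} {P : B → Set} (P? : Decidable P) (f : A → B) xs →
            count P? (map f xs) ≡ count (λ x → P? (f x)) xs
count-map P? f []       = refl
count-map P? f (x ∷ xs) with does (P? (f x))
... | true  = cong suc (count-map P? f xs)
... | false = count-map P? f xs

count-cartesianProduct : ∀ {A B : Set} {Q : A × B → Set} (Q? : Decidable Q) xs ys →
  count Q? (cartesianProduct xs ys) ≡ sum (map (λ x → count (λ y → Q? (x , y)) ys) xs)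
count-cartesianProduct Q? []       ys = refl
count-cartesianProduct Q? (x ∷ xs) ys =
  trans (count-++ Q? (map (x ,_) ys) (cartesianProduct xs ys))
        (cong₂ _+_ (count-map Q? (x ,_) ys) (count-cartesianProduct Q? xs ys))

count-cartesianProduct-+ : ∀ {A B : Set} {Q : A × B → Set} {P : A → Set} (Q? : Decidable Q) (P? : Decidable P)
  (h : A → ℕ) xs ys → (∀ x → x ∈ xs → count (λ y → Q? (x , y)) ys + count P? [ x ] ≡ h x) →
  count Q? (cartesianProduct xs ys) + count P? xs ≡ sum (map h xs)
count-cartesianProduct-+ Q? P? h xs ys pointwise = begin
  count Q? (cartesianProduct xs ys) + count P? xs
    ≡⟨ cong₂ _+_ (count-cartesianProduct Q? xs ys) (sym (sum-count-[] P? xs)) ⟩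
  sum (map (λ x → count (λ y → Q? (x , y)) ys) xs) + sum (map (λ x → count P? [ x ]) xs)
    ≡⟨ sum-map-+ _ _ h xs pointwise ⟩
  sum (map h xs) ∎
  where open ≡-Reasoning

unique-map-∈ : ∀ {A B : Set} (f : A → B) {xs} → (∀ {x y} → x ∈ xs → y ∈ xs → f x ≡ f y → x ≡ y) →
               Unique xs → Unique (map f xs)
unique-map-∈ f injective [] = []
unique-map-∈ f injective (x∉xs ∷ unique) =
  All.map⁺ (All.tabulate (λ y∈ fx≡fy → All.lookup x∉xs y∈ (injective (here refl) (there y∈) fx≡fy)))
  ∷ unique-map-∈ f (λ x∈ y∈ → injective (there x∈) (there y∈)) unique

hasCount-map-filter : ∀ {A B : Set} {P : A → Set} {Q : B → Set} (g : B → A) (Q? : Decidable Q) (candidates : List B) →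
  Unique candidates →
  (∀ {p q} → p ∈ candidates → q ∈ candidates → g p ≡ g q → p ≡ q) →
  (∀ p → p ∈ candidates → Q p → P (g p)) →
  (∀ x → P x → ∃ λ p → p ∈ candidates × x ≡ g p × Q p) →
  HasCount P (count Q? candidates)
hasCount-map-filter {P = P} g Q? candidates unique injective sound complete =
  map g (filter Q? candidates) ,
  unique-map-∈ g (λ p∈ q∈ → injective (proj₁ (∈-filter⁻ Q? p∈)) (proj₁ (∈-filter⁻ Q? q∈))) (Unique.filter⁺ Q? unique) ,
  length-map g (filter Q? candidates) ,
  λ x → mk⇔ (enumerated x) (λ Px → ∈-map∘filter⁺ g Q? (complete x Px))
  where
  enumerated : ∀ x → x ∈ map g (filter Q? candidates) → P x
  enumerated x x∈ with ∈-map∘filter⁻ g Q? x∈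
  ... | p , p∈ , refl , Qp = sound p p∈ Qp

coprime-to? : ∀ m → Decidable (λ x → gcd x m ≡ 1)
coprime-to? m x = gcd x m ≟ 1

count-coprime-range-suc : ∀ m u → 1 ≤ m →
  count (coprime-to? m) (range (suc u) m) ≡ count (coprime-to? m) (range u m)
count-coprime-range-suc (suc m) u _ = begin
  count C? (range (suc u) (suc m))
    ≡⟨ cong (count C?) (range-∷ʳ (suc u) m) ⟩
  count C? (range (suc u) m ++ [ suc u + m ])
    ≡⟨ count-++ C? (range (suc u) m) _ ⟩
  count C? (range (suc u) m) + count C? [ suc u + m ]
    ≡⟨ cong (count C? (range (suc u) m) +_) (count-[]-cong C? C? (suc u + m) u gcd-shift) ⟩
  count C? (range (suc u) m) + count C? [ u ]
    ≡⟨ +-comm _ (count C? [ u ]) ⟩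
  count C? [ u ] + count C? (range (suc u) m)
    ≡⟨ count-++ C? [ u ] (range (suc u) m) ⟨
  count C? (range u (suc m))
    ∎
  where
  open ≡-Reasoning
  C? : Decidable (λ x → gcd x (suc m) ≡ 1)
  C? = coprime-to? (suc m)
  gcd-shift : gcd (suc u + m) (suc m) ≡ 1 ⇔ gcd u (suc m) ≡ 1
  gcd-shift = ≡1-resp (trans (cong (λ t → gcd (suc t) (suc m)) (+-comm u m)) (gcd[m+n,m]≡gcd[n,m] (suc m) u))

count-coprime-range : ∀ m u → 1 ≤ m → count (coprime-to? m) (range u m) ≡ φ m
count-coprime-range m u 1≤m =
  trans (shift u) (sym (trans (cong (count (coprime-to? m)) (map-suc-upTo m)) (shift 1)))
  where
  shift : ∀ u → count (coprime-to? m) (range u m) ≡ count (coprime-to? m) (range 0 m)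
  shift zero    = refl
  shift (suc u) = trans (count-coprime-range-suc m u 1≤m) (shift u)

count-coprime-below : ∀ k → 1 ≤ k → count (coprime-to? (suc k)) (range 1 k) ≡ φ (suc k)
count-coprime-below k 1≤k = sym (begin
  φ n                                    ≡⟨ count-coprime-range n 1 (s≤s z≤n) ⟨
  count C? (range 1 (suc k))             ≡⟨ cong (count C?) (range-∷ʳ 1 k) ⟩
  count C? (range 1 k ++ [ n ])          ≡⟨ count-++ C? (range 1 k) [ n ] ⟩
  count C? (range 1 k) + count C? [ n ]  ≡⟨ cong (count C? (range 1 k) +_) (count-none C? [ n ] n-not-coprime) ⟩
  count C? (range 1 k) + 0               ≡⟨ +-identityʳ _ ⟩
  count C? (range 1 k)                   ∎)
  where
  open ≡-Reasoning
  n : ℕ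
  n = suc k
  C? : Decidable (λ x → gcd x n ≡ 1)
  C? = coprime-to? n
  n-not-coprime : ∀ x → x ∈ [ n ] → gcd x n ≢ 1
  n-not-coprime x (here refl) gcd≡1 = <⇒≢ (s≤s 1≤k) (sym (trans (sym (gcd[n,n]≡n n)) gcd≡1))

-- Counting lieanders

composition₁ : ∀ {n c} → IsComposition n 1 c → c ≡ n ∷ []
composition₁ {c = x ∷ []} (_ , refl , x+0≡n) = cong [_] (trans (sym (+-identityʳ x)) x+0≡n)

composition₂ : ∀ {n c} → IsComposition n 2 c → ∃ λ a → c ≡ a ∷ (n ∸ a) ∷ [] × 1 ≤ a × a < n
composition₂ {n} {x ∷ y ∷ []} ((1≤x All.∷ 1≤y All.∷ All.[]) , refl , sum≡n) =
  x , cong (λ t → x ∷ t ∷ []) (sym (trans (cong (_∸ x) (sym x+y≡n)) (m+n∸m≡n x y))) ,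
  1≤x , subst (x <_) x+y≡n (m<m+n x 1≤y)
  where
  x+y≡n : x + y ≡ n
  x+y≡n = trans (cong (x +_) (sym (+-identityʳ y))) sum≡n

composition₃ : ∀ {n c} → IsComposition n 3 c →
  ∃₂ λ x y → ∃ λ z → c ≡ x ∷ y ∷ z ∷ [] × 1 ≤ x × 1 ≤ y × 1 ≤ z × x + y + z ≡ n
composition₃ {n} {x ∷ y ∷ z ∷ []} ((1≤x All.∷ 1≤y All.∷ 1≤z All.∷ All.[]) , refl , sum≡n) =
  x , y , z , refl , 1≤x , 1≤y , 1≤z , trans (regroup x y z) sum≡n
  where
  regroup : ∀ x y z → x + y + z ≡ x + (y + (z + 0))
  regroup = solve-∀

composition-[n] : ∀ {n} → 1 ≤ n → IsComposition n 1 (n ∷ [])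
composition-[n] 1≤n = (1≤n All.∷ All.[]) , refl , +-identityʳ _

composition-[a,n∸a] : ∀ {n a} → 1 ≤ a → a < n → IsComposition n 2 (a ∷ (n ∸ a) ∷ [])
composition-[a,n∸a] {n} {a} 1≤a a<n =
  (1≤a All.∷ m<n⇒0<n∸m a<n All.∷ All.[]) , refl ,
  trans (cong (a +_) (+-identityʳ (n ∸ a))) (m+[n∸m]≡n (<⇒≤ a<n))

composition-[a,b,c] : ∀ {a b c} → 1 ≤ a → 1 ≤ b → 1 ≤ c → IsComposition (a + b + c) 3 (a ∷ b ∷ c ∷ [])
composition-[a,b,c] {a} {b} {c} 1≤a 1≤b 1≤c = (1≤a All.∷ 1≤b All.∷ 1≤c All.∷ All.[]) , refl , regroup a b c
  where
  regroup : ∀ a b c → a + (b + (c + 0)) ≡ a + b + c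
  regroup = solve-∀

lieanders₂₁ : ∀ n → 2 ≤ n → L n 2 1 (φ n)
lieanders₂₁ (suc k) (s≤s 1≤k) = subst (L n 2 1) (count-coprime-below k 1≤k)
  (hasCount-map-filter pair (coprime-to? n) (range 1 k) (range-unique 1 k)
    (λ _ _ e → ∷-injectiveˡ (,-injectiveˡ e)) sound complete)
  where
  n : ℕ
  n = suc k
  pair : ℕ → List ℕ × List ℕ
  pair a = a ∷ (n ∸ a) ∷ [] , n ∷ []

  sound : ∀ a → a ∈ range 1 k → gcd a n ≡ 1 → IsLieander n 2 1 (pair a)
  sound a a∈ gcd≡1 with ∈-range⁻ 1 k a∈
  ... | 1≤a , a<n = composition-[a,n∸a] 1≤a a<n , composition-[n] (s≤s z≤n) ,
                    Equivalence.from (transitive₂₁⇔coprime 1≤a a<n) gcd≡1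

  complete : ∀ x → IsLieander n 2 1 x → ∃ λ a → a ∈ range 1 k × x ≡ pair a × gcd a n ≡ 1
  complete (c⁺ , c⁻) (comp⁺ , comp⁻ , T) with composition₂ comp⁺ | composition₁ comp⁻
  ... | a , refl , 1≤a , a<n | refl =
    a , ∈-range⁺ 1 k 1≤a a<n , refl , Equivalence.to (transitive₂₁⇔coprime 1≤a a<n) T

module Lieanders₂₂ (k′ : ℕ) where

  k n : ℕ
  k = suc k′
  n = suc k

  R : List ℕ
  R = range 1 k

  pair : ℕ × ℕ → List ℕ × List ℕ
  pair (a , b) = a ∷ (n ∸ a) ∷ [] , b ∷ (n ∸ b) ∷ []
  Q : ℕ × ℕ → Set
  Q (a , b) = gcd (b + (n ∸ a)) n ≡ 1
  Q? : Decidable Q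
  Q? (a , b) = coprime-to? n (b + (n ∸ a))

  sound : ∀ p → p ∈ cartesianProduct R R → Q p → IsLieander n 2 2 (pair p)
  sound (a , b) p∈ gcd≡1 with ∈-cartesianProduct⁻ R R p∈
  ... | a∈ , b∈ with ∈-range⁻ 1 k a∈ | ∈-range⁻ 1 k b∈
  ...   | 1≤a , a<n | 1≤b , b<n = composition-[a,n∸a] 1≤a a<n , composition-[a,n∸a] 1≤b b<n ,
                                  Equivalence.from (transitive₂₂⇔coprime 1≤a a<n 1≤b b<n) gcd≡1

  complete : ∀ x → IsLieander n 2 2 x → ∃ λ p → p ∈ cartesianProduct R R × x ≡ pair p × Q p
  complete (c⁺ , c⁻) (comp⁺ , comp⁻ , T) with composition₂ comp⁺ | composition₂ comp⁻
  ... | a , refl , 1≤a , a<n | b , refl , 1≤b , b<n =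
    (a , b) , ∈-cartesianProduct⁺ (∈-range⁺ 1 k 1≤a a<n) (∈-range⁺ 1 k 1≤b b<n) ,
    refl , Equivalence.to (transitive₂₂⇔coprime 1≤a a<n 1≤b b<n) T

  pointwise : ∀ a → a ∈ R → count (λ b → Q? (a , b)) R + count (coprime-to? n) [ a ] ≡ φ n
  pointwise a a∈ = begin
    count (λ b → Q? (a , b)) R + count C? [ a ]
      ≡⟨ cong₂ _+_ (count-map C? (_+ (n ∸ a)) R) (count-[]-cong C? C? (n ∸ a) a gcd-reflect) ⟨
    count C? (map (_+ (n ∸ a)) R) + count C? [ n ∸ a ]
      ≡⟨ cong (λ xs → count C? xs + count C? [ n ∸ a ]) (map-+-range (n ∸ a) 1 k) ⟩
    count C? (range (suc (n ∸ a)) k) + count C? [ n ∸ a ]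
      ≡⟨ +-comm _ (count C? [ n ∸ a ]) ⟩
    count C? [ n ∸ a ] + count C? (range (suc (n ∸ a)) k)
      ≡⟨ count-++ C? [ n ∸ a ] (range (suc (n ∸ a)) k) ⟨
    count C? (range (n ∸ a) n)
      ≡⟨ count-coprime-range n (n ∸ a) (s≤s z≤n) ⟩
    φ n
      ∎
    where
    open ≡-Reasoning
    C? : Decidable (λ x → gcd x n ≡ 1)
    C? = coprime-to? n
    gcd-reflect : gcd (n ∸ a) n ≡ 1 ⇔ gcd a n ≡ 1
    gcd-reflect = ≡1-resp (gcd[n∸m,n]≡gcd[m,n] (<⇒≤ (proj₂ (∈-range⁻ 1 k a∈))))

  count≡ : count Q? (cartesianProduct R R) ≡ k′ * φ n
  count≡ = +-cancelʳ-≡ (φ n) _ _ (begin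
    count Q? (cartesianProduct R R) + φ n
      ≡⟨ cong (count Q? (cartesianProduct R R) +_) (count-coprime-below k (s≤s z≤n)) ⟨
    count Q? (cartesianProduct R R) + count (coprime-to? n) R
      ≡⟨ count-cartesianProduct-+ Q? (coprime-to? n) (λ _ → φ n) R R pointwise ⟩
    sum (map (λ _ → φ n) R)  ≡⟨ sum-map-const (φ n) R ⟩
    length R * φ n           ≡⟨ cong (_* φ n) (length-range 1 k) ⟩
    φ n + k′ * φ n           ≡⟨ +-comm (φ n) (k′ * φ n) ⟩
    k′ * φ n + φ n           ∎)
    where open ≡-Reasoning

lieanders₂₂ : ∀ n → 2 ≤ n → L n 2 2 ((n ∸ 2) * φ n)
lieanders₂₂ (suc (suc k′)) (s≤s (s≤s z≤n)) = subst (L n 2 2) count≡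
  (hasCount-map-filter pair Q? (cartesianProduct R R) (Unique.cartesianProduct⁺ (range-unique 1 k) (range-unique 1 k))
    (λ _ _ e → cong₂ _,_ (∷-injectiveˡ (,-injectiveˡ e)) (∷-injectiveˡ (,-injectiveʳ e))) sound complete)
  where open Lieanders₂₂ k′

lieander₃₁ : ∀ {a b c} → 1 ≤ a → 1 ≤ b → 1 ≤ c → gcd (a + b) (b + c) ≡ 1 →
             IsLieander (a + b + c) 3 1 (a ∷ b ∷ c ∷ [] , (a + b + c) ∷ [])
lieander₃₁ {a} {b} {c} 1≤a 1≤b 1≤c gcd≡1 =
  composition-[a,b,c] 1≤a 1≤b 1≤c ,
  composition-[n] (≤-trans 1≤a (≤-trans (m≤m+n a b) (m≤m+n (a + b) c))) ,
  Equivalence.from (transitive₃₁⇔coprime 1≤a 1≤b) gcd≡1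

module Lieanders₃₁ (k : ℕ) (1≤k : 1 ≤ k) where

  n : ℕ
  n = suc k

  R : List ℕ
  R = range 1 k

  Q : ℕ × ℕ → Set
  Q (s , t) = n < s + t × gcd t s ≡ 1
  Q? : Decidable Q
  Q? (s , t) = (n <? s + t) ×-dec coprime-to? s t

  triple : ℕ × ℕ → List ℕ × List ℕ
  triple (s , t) = (n ∸ t) ∷ (s + t ∸ n) ∷ (n ∸ s) ∷ [] , n ∷ []

  <n : ∀ {x} → x ∈ R → x ≤ n
  <n x∈ = <⇒≤ (proj₂ (∈-range⁻ 1 k x∈))

  injective : ∀ {p q} → p ∈ cartesianProduct R R → q ∈ cartesianProduct R R → triple p ≡ triple q → p ≡ q
  injective {s , t} {s′ , t′} p∈ q∈ e with ∈-cartesianProduct⁻ R R p∈ | ∈-cartesianProduct⁻ R R q∈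
  ... | s∈ , t∈ | s′∈ , t′∈ = cong₂ _,_
    (∸-cancelˡ-≡ (<n s∈) (<n s′∈) (∷-injectiveˡ (∷-injectiveʳ (∷-injectiveʳ (,-injectiveˡ e)))))
    (∸-cancelˡ-≡ (<n t∈) (<n t′∈) (∷-injectiveˡ (,-injectiveˡ e)))

  sound : ∀ p → p ∈ cartesianProduct R R → Q p → IsLieander n 3 1 (triple p)
  sound (s , t) p∈ (n<s+t , gcd≡1) with ∈-cartesianProduct⁻ R R p∈
  ... | s∈ , t∈ with ∈-range⁻ 1 k s∈ | ∈-range⁻ 1 k t∈
  ...   | _ , s<n | _ , t<n with m≤n⇒∃[o]m+o≡n (<⇒≤ t<n) | m≤n⇒∃[o]m+o≡n (<⇒≤ n<s+t) | m≤n⇒∃[o]m+o≡n (<⇒≤ s<n)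
  ...     | a , t+a≡n | b , n+b≡s+t | c , s+c≡n = subst (IsLieander n 3 1) (sym triple≡)
    (subst (λ m → IsLieander m 3 1 (a ∷ b ∷ c ∷ [] , m ∷ [])) a+b+c≡n
      (lieander₃₁ (subst (1 ≤_) a≡ (m<n⇒0<n∸m t<n)) (subst (1 ≤_) b≡ (m<n⇒0<n∸m n<s+t)) (subst (1 ≤_) c≡ (m<n⇒0<n∸m s<n))
        (trans (cong₂ gcd a+b≡s b+c≡t) (trans (gcd-comm s t) gcd≡1))))
    where
    a≡ : n ∸ t ≡ a
    a≡ = trans (cong (_∸ t) (sym t+a≡n)) (m+n∸m≡n t a)
    b≡ : s + t ∸ n ≡ b
    b≡ = trans (cong (_∸ n) (sym n+b≡s+t)) (m+n∸m≡n n b)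
    c≡ : n ∸ s ≡ c
    c≡ = trans (cong (_∸ s) (sym s+c≡n)) (m+n∸m≡n s c)
    triple≡ : triple (s , t) ≡ (a ∷ b ∷ c ∷ [] , n ∷ [])
    triple≡ = cong (_, n ∷ []) (cong₂ _∷_ a≡ (cong₂ _∷_ b≡ (cong [_] c≡)))
    a+b≡s : a + b ≡ s
    a+b≡s = +-cancelˡ-≡ t _ _ (trans (sym (+-assoc t a b)) (trans (cong (_+ b) t+a≡n) (trans n+b≡s+t (+-comm s t))))
    b+c≡t : b + c ≡ t
    b+c≡t = +-cancelˡ-≡ s _ _ (trans (regroup s b c) (trans (cong (_+ b) s+c≡n) n+b≡s+t))
      where
      regroup : ∀ s b c → s + (b + c) ≡ (s + c) + b
      regroup = solve-∀
    a+b+c≡n : a + b + c ≡ n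
    a+b+c≡n = trans (cong (_+ c) a+b≡s) s+c≡n

  complete : ∀ x → IsLieander n 3 1 x → ∃ λ p → p ∈ cartesianProduct R R × x ≡ triple p × Q p
  complete (c⁺ , c⁻) (comp⁺ , comp⁻ , T) with composition₃ comp⁺ | composition₁ comp⁻
  ... | x , y , z , refl , 1≤x , 1≤y , 1≤z , x+y+z≡n | refl =
    (x + y , y + z) ,
    ∈-cartesianProduct⁺ (∈-range⁺ 1 k (≤-trans 1≤x (m≤m+n x y)) x+y<n) (∈-range⁺ 1 k (≤-trans 1≤y (m≤m+n y z)) y+z<n) ,
    cong (_, n ∷ []) (cong₂ _∷_ (sym x≡) (cong₂ _∷_ (sym y≡) (cong [_] (sym z≡)))) ,
    n<x+y+[y+z] , trans (gcd-comm (y + z) (x + y)) (Equivalence.to (transitive₃₁⇔coprime 1≤x 1≤y) T′)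
    where
    rotate : ∀ x y z → y + z + x ≡ x + y + z
    rotate = solve-∀
    x+y<n : x + y < n
    x+y<n = subst (x + y <_) x+y+z≡n (m<m+n (x + y) 1≤z)
    y+z<n : y + z < n
    y+z<n = subst (y + z <_) (trans (rotate x y z) x+y+z≡n) (m<m+n (y + z) 1≤x)
    regroup : ∀ x y z → x + y + (y + z) ≡ x + y + z + y
    regroup = solve-∀
    n<x+y+[y+z] : n < x + y + (y + z)
    n<x+y+[y+z] = subst (_< x + y + (y + z)) x+y+z≡n (subst (x + y + z <_) (sym (regroup x y z)) (m<m+n (x + y + z) 1≤y))
    x≡ : n ∸ (y + z) ≡ x
    x≡ = trans (cong (_∸ (y + z)) (trans (sym x+y+z≡n) (sym (rotate x y z)))) (m+n∸m≡n (y + z) x)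
    y≡ : x + y + (y + z) ∸ n ≡ y
    y≡ = trans (cong (_∸ n) (trans (regroup x y z) (cong (_+ y) x+y+z≡n))) (m+n∸m≡n n y)
    z≡ : n ∸ (x + y) ≡ z
    z≡ = trans (cong (_∸ (x + y)) (sym x+y+z≡n)) (m+n∸m≡n (x + y) z)
    T′ : Transitive (x + y + z) (x ∷ y ∷ z ∷ []) ((x + y + z) ∷ [])
    T′ = subst (λ m → Transitive m (x ∷ y ∷ z ∷ []) (m ∷ [])) (sym x+y+z≡n) T

  pointwise : ∀ s → s ∈ R → count (λ t → Q? (s , t)) R + count (coprime-to? n) [ s ] ≡ φ s
  pointwise zero s∈ with () ← proj₁ (∈-range⁻ 1 k s∈)
  pointwise (suc s′) s∈ with m≤n⇒∃[o]m+o≡n (≤-pred (proj₂ (∈-range⁻ 1 k s∈)))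
  ... | r , s+r≡k = begin
    count Qs R + count (coprime-to? n) [ s ]
      ≡⟨ cong (λ xs → count Qs xs + count (coprime-to? n) [ s ]) (trans (cong (range 1) k≡) (range-++ 1 (suc r) s′)) ⟩
    count Qs (range 1 (suc r) ++ range (2 + r) s′) + count (coprime-to? n) [ s ]
      ≡⟨ cong (_+ count (coprime-to? n) [ s ]) (count-++ Qs (range 1 (suc r)) (range (2 + r) s′)) ⟩
    count Qs (range 1 (suc r)) + count Qs (range (2 + r) s′) + count (coprime-to? n) [ s ]
      ≡⟨ cong₂ _+_ (cong₂ _+_ (count-none Qs (range 1 (suc r)) short) (count-cong-∈ Qs Cs (range (2 + r) s′) long))
                   (count-[]-cong (coprime-to? n) Cs s n (≡1-resp (gcd-comm s n))) ⟩
    count Cs (range (2 + r) s′) + count Cs [ n ]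
      ≡⟨ count-++ Cs (range (2 + r) s′) [ n ] ⟨
    count Cs (range (2 + r) s′ ++ [ n ])
      ≡⟨ cong (λ m → count Cs (range (2 + r) s′ ++ [ m ])) n≡ ⟩
    count Cs (range (2 + r) s′ ++ [ 2 + r + s′ ])
      ≡⟨ cong (count Cs) (range-∷ʳ (2 + r) s′) ⟨
    count Cs (range (2 + r) s)
      ≡⟨ count-coprime-range s (2 + r) (s≤s z≤n) ⟩
    φ s ∎
    where
    open ≡-Reasoning
    s : ℕ
    s = suc s′
    Qs : Decidable (λ t → Q (s , t))
    Qs t = Q? (s , t)
    Cs : Decidable (λ x → gcd x s ≡ 1)
    Cs = coprime-to? s
    k≡ : k ≡ suc r + s′
    k≡ = trans (sym s+r≡k) (cong suc (+-comm s′ r))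
    n≡ : n ≡ 2 + r + s′
    n≡ = cong suc k≡
    s+suc[r]≡n : s + suc r ≡ n
    s+suc[r]≡n = trans (+-suc s r) (cong suc s+r≡k)
    short : ∀ t → t ∈ range 1 (suc r) → ¬ Q (s , t)
    short t t∈ (n<s+t , _) = <⇒≱ n<s+t
      (≤-trans (+-monoʳ-≤ s (≤-pred (proj₂ (∈-range⁻ 1 (suc r) t∈)))) (≤-reflexive s+suc[r]≡n))
    long : ∀ t → t ∈ range (2 + r) s′ → Q (s , t) ⇔ gcd t s ≡ 1
    long t t∈ = mk⇔ proj₂ (n<s+t ,_)
      where
      n<s+t : n < s + t
      n<s+t = subst (_< s + t) s+suc[r]≡n
        (≤-trans (≤-reflexive (sym (+-suc s (suc r)))) (+-monoʳ-≤ s (proj₁ (∈-range⁻ (2 + r) s′ t∈))))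

  count≡ : count Q? (cartesianProduct R R) + φ n ≡ sumφBelow n
  count≡ = begin
    count Q? (cartesianProduct R R) + φ n
      ≡⟨ cong (count Q? (cartesianProduct R R) +_) (count-coprime-below k 1≤k) ⟨
    count Q? (cartesianProduct R R) + count (coprime-to? n) R
      ≡⟨ count-cartesianProduct-+ Q? (coprime-to? n) φ R R pointwise ⟩
    sum (map φ R)
      ≡⟨ cong (λ xs → sum (map φ xs)) (map-suc-upTo k) ⟨
    sumφBelow n
      ∎
    where open ≡-Reasoning

lieanders₃₁ : ∀ n → 2 ≤ n → Σ ℕ (λ m → L n 3 1 m × m + φ n ≡ sumφBelow n)
lieanders₃₁ (suc k) (s≤s 1≤k) = count Q? (cartesianProduct R R) ,
  hasCount-map-filter triple Q? (cartesianProduct R R) (Unique.cartesianProduct⁺ (range-unique 1 k) (range-unique 1 k))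
    injective sound complete ,
  count≡
  where open Lieanders₃₁ k 1≤k

corollary3 : (n : ℕ) → 2 ≤ n →
    L n 2 1 (φ n)
    × Σ ℕ (λ m → L n 3 1 m × m + φ n ≡ sumφBelow n)
    × L n 2 2 ((n ∸ 2) * φ n)
corollary3 n 2≤n = lieanders₂₁ n 2≤n , lieanders₃₁ n 2≤n , lieanders₂₂ n 2≤n
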